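{- Let $n\geq 2$ be an integer. Suppose there exist $p_1<p_2$ in $[1,2n]$, where $p_2$ is a prime and $p_1$ is either a prime or $p_1=1$, such that $2n+p_1$ and $2n+p_2$ are both prime and $\gcd\left(\frac{p_2-p_1}{2},\,n\right)=1$. Then the prime sum graph $G_{2n}$ contains a Hamilton cycle.
   Context: For a positive integer $m$, the prime sum graph $G_m$ is the graph with vertex set $\{1,2,\dots,m\}$ in which two distinct vertices $i,j$ are adjacent if and only if $i+j$ is a prime number. A Hamilton cycle is a cycle visiting every vertex exactly once. -}

module Defs where

open import Data.Nat using (ℕ; suc; _+_)
open import Data.Nat.Primality using (Prime)
open import Data.List using (List; []; _∷_; map; upTo)
open import Data.List.Relation.Binary.Permutation.Propositional using (_↭_)
open import Data.Product using (Σ; _×_)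
open import Data.Empty using (⊥)

-- adjacency in the prime sum graph: distinct vertices i, j with i + j prime
-- (distinctness of consecutive vertices is enforced by the permutation condition)
Adj : ℕ → ℕ → Set
Adj i j = Prime (i + j)

vertices : ℕ → List ℕ
vertices m = map suc (upTo m)

CycleEdges : List ℕ → Set
CycleEdges [] = ⊥
CycleEdges (x ∷ xs) = go x xs
  where
  go : ℕ → List ℕ → Set
  go y [] = Adj y x
  go y (z ∷ zs) = Adj y z × go z zs

HamiltonCycle : ℕ → List ℕ → Set
HamiltonCycle m c = (c ↭ vertices m) × CycleEdges c

HasHamiltonCycle : ℕ → Set
HasHamiltonCycle m = Σ (List ℕ) (HamiltonCycle m)

module Submission where

-- Write N = 2n and let reflect p send x ∈ [1, N] to the y ∈ [1, N] with x + y ≡ p (mod N),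
-- namely p − x or N + p − x.  Then x + reflect p x is p or N + p, so x and reflect p x are
-- adjacent in G_N as soon as p (if it exceeds 1) and N + p are prime.  Start at a₀ = 1 and
-- alternate bⱼ = reflect p₁ aⱼ, aⱼ₊₁ = reflect p₂ bⱼ.  Subtracting the two congruences gives
-- aⱼ₊₁ ≡ aⱼ + (p₂ − p₁), so aⱼ ≡ 1 + j (p₂ − p₁) (mod N).  As p₂ − p₁ = 2k with gcd k n = 1,
-- a₀, …, aₙ₋₁ are the n odd vertices, b₀, …, bₙ₋₁ are the n even ones, and aₙ = 1 closes
-- the cycle a₀ b₀ a₁ b₁ … aₙ₋₁ bₙ₋₁.

open import Defs
open import Data.Empty using (⊥-elim)
open import Data.List using (List; []; _∷_; _++_; length; upTo)
open import Data.List.Membership.Propositional using (_∈_)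
open import Data.List.Membership.Propositional.Properties using (∈-∃++; ∈-++⁻; ∈-++⁺ˡ; ∈-++⁺ʳ; ∈-map⁺; ∈-upTo⁺)
open import Data.List.Properties using (length-++-sucʳ; length-map; length-upTo)
open import Data.List.Relation.Binary.Permutation.Propositional using (_↭_; ↭-refl; ↭-trans; ↭-sym; prep)
open import Data.List.Relation.Binary.Permutation.Propositional.Properties using (shift)
open import Data.List.Relation.Binary.Subset.Propositional using (_⊆_)
open import Data.List.Relation.Unary.All as All using ()
open import Data.List.Relation.Unary.AllPairs using ([]; _∷_)
open import Data.List.Relation.Unary.Any using (here; there)
open import Data.List.Relation.Unary.Unique.Propositional using (Unique)
open import Data.Nat using (ℕ; zero; suc; pred; _+_; _*_; _∸_; _/_; _%_; _≤_; _<_; z≤n; s≤s; _<?_; NonZero; >-nonZero; >-nonZero⁻¹)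
open import Data.Nat.Coprimality using (Coprime; coprime-divisor; gcd≡1⇒coprime) renaming (sym to coprime-sym)
open import Data.Nat.DivMod using (m≡m%n+[m/n]*n; m%n<n; [m+kn]%n≡m%n; m<n⇒m%n≡m; m/n*n≡m)
open import Data.Nat.Divisibility using (_∣_; divides; n∣m*n; ∣m+n∣m⇒∣n; ∣m∣n⇒∣m+n; m∣m*n; ∣-refl; ∣⇒≤; *-cancelʳ-∣)
open import Data.Nat.GCD using (gcd)
open import Data.Nat.Primality using (Prime; prime⇒irreducible)
open import Data.Nat.Properties
open import Algebra.Properties.CommutativeSemigroup +-commutativeSemigroup using (interchange; xy∙z≈xz∙y; xy∙z≈y∙xz)
open import Data.Product using (_×_; _,_; proj₁; proj₂; ∃; ∃₂)
open import Data.Sum using (_⊎_; inj₁; inj₂)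
open import Function using (_∘_)
open import Relation.Binary.Bundles using (Setoid)
import Relation.Binary.Reasoning.Setoid as ≈-Reasoning
open import Relation.Binary.PropositionalEquality
open import Relation.Nullary using (¬_; yes; no)

unique-⊆-↭ : ∀ {a} {A : Set a} {xs ys : List A} →
  Unique xs → xs ⊆ ys → length xs ≡ length ys → xs ↭ ys
unique-⊆-↭ {xs = []} {[]} _ _ _ = ↭-refl
unique-⊆-↭ {xs = x ∷ xs} (x∉xs ∷ xs!) xs⊆ys |xs|≡|ys| with ∈-∃++ (xs⊆ys (here refl))
... | us , vs , refl =
  ↭-trans (prep x (unique-⊆-↭ xs! xs⊆us++vs (suc-injective (trans |xs|≡|ys| (length-++-sucʳ us x vs)))))
          (↭-sym (shift x us vs))
  where
  xs⊆us++vs : xs ⊆ us ++ vs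
  xs⊆us++vs {z} z∈xs with ∈-++⁻ us (xs⊆ys (there z∈xs))
  ... | inj₁ z∈us = ∈-++⁺ˡ z∈us
  ... | inj₂ (here refl) = ⊥-elim (All.lookup x∉xs z∈xs refl)
  ... | inj₂ (there z∈vs) = ∈-++⁺ʳ us z∈vs

∈-vertices : ∀ {m z} → 1 ≤ z → z ≤ m → z ∈ vertices m
∈-vertices {z = suc z} _ z<m = ∈-map⁺ suc (∈-upTo⁺ z<m)

length-vertices : ∀ m → length (vertices m) ≡ m
length-vertices m = trans (length-map suc (upTo m)) (length-upTo m)

AdjChain : ℕ → List ℕ → ℕ → Set
AdjChain x [] y = Adj x y
AdjChain x (z ∷ zs) y = Adj x z × AdjChain z zs y

-- CycleEdges (x ∷ y ∷ zs) unfolds to Adj x y × E, where E (the edges of y ∷ zs closed up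
-- at x) comes from a function local to CycleEdges and can only be named as this factor.
ClosingEdges : ℕ → ℕ → List ℕ → Set
ClosingEdges x y zs = second (CycleEdges (x ∷ y ∷ zs)) refl
  where
  second : (T : Set) {A B : Set} → T ≡ (A × B) → Set
  second _ {B = B} _ = B

chain⇒closingEdges : ∀ x y zs → AdjChain y zs x → ClosingEdges x y zs
chain⇒closingEdges x y [] y~x = y~x
chain⇒closingEdges x y (z ∷ zs) (y~z , chain) = y~z , chain⇒closingEdges x z zs chain

chain⇒cycleEdges : ∀ x xs → AdjChain x xs x → CycleEdges (x ∷ xs)
chain⇒cycleEdges x [] x~x = x~x
chain⇒cycleEdges x (y ∷ zs) (x~y , chain) = x~y , chain⇒closingEdges x y zs chain

-- Congruence modulo m, stated without truncated subtraction.
infix 4 _≡_mod_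
_≡_mod_ : ℕ → ℕ → ℕ → Set
_≡_mod_ x y m = ∃₂ λ u v → x + u * m ≡ y + v * m

module _ {m : ℕ} where

  ≡mod-reflexive : ∀ {x y} → x ≡ y → x ≡ y mod m
  ≡mod-reflexive x≡y = 0 , 0 , cong (_+ 0) x≡y

  ≡mod-refl : ∀ {x} → x ≡ x mod m
  ≡mod-refl = ≡mod-reflexive refl

  ≡mod-sym : ∀ {x y} → x ≡ y mod m → y ≡ x mod m
  ≡mod-sym (u , v , e) = v , u , sym e

  ≡mod-trans : ∀ {x y z} → x ≡ y mod m → y ≡ z mod m → x ≡ z mod m
  ≡mod-trans {x} {y} {z} (u , v , e) (u′ , v′ , e′) = u + u′ , v′ + v , (begin
    x + (u + u′) * m       ≡⟨ +-*-distrib x u u′ ⟩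
    x + u * m + u′ * m     ≡⟨ cong (_+ u′ * m) e ⟩
    y + v * m + u′ * m     ≡⟨ xy∙z≈xz∙y y (v * m) (u′ * m) ⟩
    y + u′ * m + v * m     ≡⟨ cong (_+ v * m) e′ ⟩
    z + v′ * m + v * m     ≡⟨ +-*-distrib z v′ v ⟨
    z + (v′ + v) * m       ∎)
    where
    open ≡-Reasoning
    +-*-distrib : ∀ w s t → w + (s + t) * m ≡ w + s * m + t * m
    +-*-distrib w s t = trans (cong (w +_) (*-distribʳ-+ m s t)) (sym (+-assoc w (s * m) (t * m)))

  ≡mod-+ : ∀ {x x′ y y′} → x ≡ x′ mod m → y ≡ y′ mod m → x + y ≡ x′ + y′ mod m
  ≡mod-+ {x} {x′} {y} {y′} (u , v , e) (u′ , v′ , e′) = u + u′ , v + v′ , (begin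
    x + y + (u + u′) * m              ≡⟨ cong (x + y +_) (*-distribʳ-+ m u u′) ⟩
    x + y + (u * m + u′ * m)          ≡⟨ interchange x y (u * m) (u′ * m) ⟩
    (x + u * m) + (y + u′ * m)        ≡⟨ cong₂ _+_ e e′ ⟩
    (x′ + v * m) + (y′ + v′ * m)      ≡⟨ interchange x′ y′ (v * m) (v′ * m) ⟨
    x′ + y′ + (v * m + v′ * m)        ≡⟨ cong (x′ + y′ +_) (*-distribʳ-+ m v v′) ⟨
    x′ + y′ + (v + v′) * m            ∎)
    where open ≡-Reasoning

  +-cancelˡ-≡mod : ∀ z {x y} → z + x ≡ z + y mod m → x ≡ y mod m
  +-cancelˡ-≡mod z {x} {y} (u , v , e) =
    u , v , +-cancelˡ-≡ z _ _ (trans (sym (+-assoc z x (u * m))) (trans e (+-assoc z y (v * m))))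

  difference-≡mod-0 : ∀ {x y d} → x ≡ y mod m → x + d ≡ y mod m → d ≡ 0 mod m
  difference-≡mod-0 {x} x≡y x+d≡y =
    +-cancelˡ-≡mod x (≡mod-trans x+d≡y (≡mod-trans (≡mod-sym x≡y) (≡mod-reflexive (sym (+-identityʳ x)))))

  ≡mod-0⇒∣ : ∀ {x} → x ≡ 0 mod m → m ∣ x
  ≡mod-0⇒∣ {x} (u , v , e) = ∣m+n∣m⇒∣n (divides v (trans (+-comm (u * m) x) e)) (n∣m*n u)

  ≡mod⇒%≡ : ∀ {x y} .{{_ : NonZero m}} → x ≡ y mod m → x % m ≡ y % m
  ≡mod⇒%≡ {x} {y} (u , v , e) =
    trans (sym ([m+kn]%n≡m%n x u m)) (trans (cong (_% m) e) ([m+kn]%n≡m%n y v m))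

  ≡mod-<⇒≡ : ∀ {x y} .{{_ : NonZero m}} → x < m → y < m → x ≡ y mod m → x ≡ y
  ≡mod-<⇒≡ x<m y<m x≡y = trans (sym (m<n⇒m%n≡m x<m)) (trans (≡mod⇒%≡ x≡y) (m<n⇒m%n≡m y<m))

≡mod-setoid : ℕ → Setoid _ _
≡mod-setoid m = record
  { Carrier = ℕ
  ; _≈_ = _≡_mod m 
  ; isEquivalence = record { refl = ≡mod-refl ; sym = ≡mod-sym ; trans = ≡mod-trans }
  }

x+k*m≡x-mod : ∀ x k m → x + k * m ≡ x mod m
x+k*m≡x-mod x k m = 0 , k , +-identityʳ (x + k * m)

m+x≡x-mod : ∀ m x → m + x ≡ x mod m
m+x≡x-mod m x = 0 , 1 , trans (+-identityʳ (m + x)) (trans (+-comm m x) (cong (x +_) (sym (*-identityˡ m))))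

%-≡mod : ∀ x m .{{_ : NonZero m}} → x % m ≡ x mod m
%-≡mod x m = x / m , 0 , trans (sym (m≡m%n+[m/n]*n x m)) (sym (+-identityʳ x))

≡mod-*ʳ⇒≡mod : ∀ {x y m d} → x ≡ y mod m * d → x ≡ y mod m
≡mod-*ʳ⇒≡mod {x} {y} {m} {d} (u , v , e) =
  u * d , v * d , trans (cong (x +_) (regroup u)) (trans e (cong (y +_) (sym (regroup v))))
  where
  regroup : ∀ w → w * d * m ≡ w * (m * d)
  regroup w = trans (*-assoc w d m) (cong (w *_) (*-comm d m))

odd≢even : ∀ {x y} → x ≡ 1 mod 2 → y ≡ 0 mod 2 → x ≢ y
odd≢even x-odd y-even refl with trans (sym (≡mod⇒%≡ x-odd)) (≡mod⇒%≡ y-even)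
... | ()

prime≢2⇒odd : ∀ {p} → Prime p → p ≢ 2 → p ≡ 1 mod 2
prime≢2⇒odd {p} p-prime p≢2 with p % 2 | m%n<n p 2 | %-≡mod p 2
... | 0 | _ | 0≡p with prime⇒irreducible p-prime (≡mod-0⇒∣ (≡mod-sym 0≡p))
...   | inj₁ ()
...   | inj₂ 2≡p = ⊥-elim (p≢2 (sym 2≡p))
prime≢2⇒odd p-prime p≢2 | 1 | _ | 1≡p = ≡mod-sym 1≡p
prime≢2⇒odd p-prime p≢2 | suc (suc _) | s≤s (s≤s ()) | _

2n+2-not-prime : ∀ n .{{_ : NonZero n}} → ¬ Prime (2 * n + 2)
2n+2-not-prime n 2n+2-prime with prime⇒irreducible 2n+2-prime (∣m∣n⇒∣m+n (m∣m*n n) ∣-refl)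
... | inj₁ ()
... | inj₂ 2≡2n+2 = <-irrefl 2≡2n+2 (m<n+m 2 (>-nonZero⁻¹ (2 * n) {{m*n≢0 2 n}}))

odd-summand : ∀ n {p} .{{_ : NonZero n}} → Prime p ⊎ p ≡ 1 → Prime (2 * n + p) → p ≡ 1 mod 2
odd-summand n (inj₁ p-prime) 2n+p-prime =
  prime≢2⇒odd p-prime (λ { refl → 2n+2-not-prime n 2n+p-prime })
odd-summand n (inj₂ refl) _ = ≡mod-refl

odd-difference : ∀ {p₁ p₂} → p₁ ≡ 1 mod 2 → p₂ ≡ 1 mod 2 → p₁ ≤ p₂ → p₂ ≡ p₁ + (p₂ ∸ p₁) / 2 * 2
odd-difference {p₁} {p₂} p₁-odd p₂-odd p₁≤p₂ = begin
  p₂                       ≡⟨ m+[n∸m]≡n p₁≤p₂ ⟨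
  p₁ + (p₂ ∸ p₁)           ≡⟨ cong (p₁ +_) (m/n*n≡m (≡mod-0⇒∣ difference-even)) ⟨
  p₁ + (p₂ ∸ p₁) / 2 * 2   ∎
  where
  open ≡-Reasoning
  difference-even : p₂ ∸ p₁ ≡ 0 mod 2
  difference-even = difference-≡mod-0 p₁-odd (≡mod-trans (≡mod-reflexive (m+[n∸m]≡n p₁≤p₂)) p₂-odd)

coprime⇒*≢0-mod : ∀ {k n d} → Coprime k n → 0 < d → d < n → ¬ d * (k * 2) ≡ 0 mod 2 * n
coprime⇒*≢0-mod {k} {n} {d} k⊥n 0<d d<n d*2k≡0 = <⇒≱ d<n (∣⇒≤ {{>-nonZero 0<d}} n∣d)
  where
  n∣d*k : n ∣ d * k
  n∣d*k = *-cancelʳ-∣ 2 (subst₂ _∣_ (*-comm 2 n) (sym (*-assoc d k 2)) (≡mod-0⇒∣ d*2k≡0))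
  n∣d : n ∣ d
  n∣d = coprime-divisor (coprime-sym k⊥n) (subst (n ∣_) (*-comm d k) n∣d*k)

adj-of-sum : ∀ {N p x y} → Prime p ⊎ p ≡ 1 → Prime (N + p) → 1 ≤ x → 1 ≤ y →
  x + y ≡ p ⊎ x + y ≡ N + p → Adj x y
adj-of-sum (inj₁ p-prime) _ _ _ (inj₁ x+y≡p) = subst Prime (sym x+y≡p) p-prime
adj-of-sum {x = suc x} (inj₂ refl) _ _ (s≤s _) (inj₁ x+y≡1) = ⊥-elim (m+1+n≢0 x (suc-injective x+y≡1))
adj-of-sum _ N+p-prime _ _ (inj₂ x+y≡N+p) = subst Prime (sym x+y≡N+p) N+p-prime

module Reflection (N : ℕ) where

  reflect : ℕ → ℕ → ℕ
  reflect p x with x <? p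
  ... | yes _ = p ∸ x
  ... | no  _ = N + p ∸ x

  reflect-sum : ∀ p {x} → x ≤ N → x + reflect p x ≡ p ⊎ x + reflect p x ≡ N + p
  reflect-sum p {x} x≤N with x <? p
  ... | yes x<p = inj₁ (m+[n∸m]≡n (<⇒≤ x<p))
  ... | no  _   = inj₂ (m+[n∸m]≡n (≤-trans x≤N (m≤m+n N p)))

  reflect-≡mod : ∀ p {x} → x ≤ N → x + reflect p x ≡ p mod N
  reflect-≡mod p x≤N with reflect-sum p x≤N
  ... | inj₁ x+y≡p   = ≡mod-reflexive x+y≡p
  ... | inj₂ x+y≡N+p = ≡mod-trans (≡mod-reflexive x+y≡N+p) (m+x≡x-mod N p)

  reflect-range : ∀ {p x} → 1 ≤ p → p ≤ N → x ≤ N → 1 ≤ reflect p x × reflect p x ≤ N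
  reflect-range {p} {x} 1≤p p≤N x≤N with x <? p
  ... | yes x<p = m<n⇒0<n∸m x<p , ≤-trans (m∸n≤m p x) p≤N
  ... | no  x≮p = m<n⇒0<n∸m (≤-<-trans x≤N (m<m+n N 1≤p))
                , ≤-trans (∸-monoʳ-≤ (N + p) (≮⇒≥ x≮p)) (≤-reflexive (m+n∸n≡m N p))

module AlternatingWalk (n k p₁ p₂ : ℕ) .{{_ : NonZero n}}
  (1≤p₁ : 1 ≤ p₁) (p₁≤2n : p₁ ≤ 2 * n) (1≤p₂ : 1 ≤ p₂) (p₂≤2n : p₂ ≤ 2 * n)
  (p₁-odd : p₁ ≡ 1 mod 2) (p₂≡p₁+2k : p₂ ≡ p₁ + k * 2 mod 2 * n) (k⊥n : Coprime k n) where

  N : ℕ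
  N = 2 * n

  instance
    N-nonZero : NonZero N
    N-nonZero = m*n≢0 2 n

  open Reflection N

  a b : ℕ → ℕ
  a zero    = 1
  a (suc j) = reflect p₂ (b j)
  b j = reflect p₁ (a j)

  a-range : ∀ j → 1 ≤ a j × a j ≤ N
  b-range : ∀ j → 1 ≤ b j × b j ≤ N
  a-range zero    = s≤s z≤n , ≤-trans 1≤p₁ p₁≤2n
  a-range (suc j) = reflect-range 1≤p₂ p₂≤2n (proj₂ (b-range j))
  b-range j       = reflect-range 1≤p₁ p₁≤2n (proj₂ (a-range j))

  a+b≡p₁ : ∀ j → a j + b j ≡ p₁ mod N
  a+b≡p₁ j = reflect-≡mod p₁ (proj₂ (a-range j))

  b+a≡p₂ : ∀ j → b j + a (suc j) ≡ p₂ mod N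
  b+a≡p₂ j = reflect-≡mod p₂ (proj₂ (b-range j))

  a-step : ∀ j → a (suc j) ≡ a j + k * 2 mod N
  a-step j = +-cancelˡ-≡mod (b j) (begin
    b j + a (suc j)        ≈⟨ b+a≡p₂ j ⟩
    p₂                     ≈⟨ p₂≡p₁+2k ⟩
    p₁ + k * 2             ≈⟨ ≡mod-+ (≡mod-sym (a+b≡p₁ j)) ≡mod-refl ⟩
    a j + b j + k * 2      ≡⟨ xy∙z≈y∙xz (a j) (b j) (k * 2) ⟩
    b j + (a j + k * 2)    ∎)
    where open ≈-Reasoning (≡mod-setoid N)

  a-≡mod : ∀ j → a j ≡ 1 + j * (k * 2) mod N
  a-≡mod zero    = ≡mod-refl
  a-≡mod (suc j) = begin
    a (suc j)                    ≈⟨ a-step j ⟩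
    a j + k * 2                  ≈⟨ ≡mod-+ (a-≡mod j) ≡mod-refl ⟩
    1 + j * (k * 2) + k * 2      ≡⟨ cong suc (+-comm (j * (k * 2)) (k * 2)) ⟩
    1 + suc j * (k * 2)          ∎
    where open ≈-Reasoning (≡mod-setoid N)

  a-odd : ∀ j → a j ≡ 1 mod 2
  a-odd j = begin
    a j                ≈⟨ ≡mod-*ʳ⇒≡mod {d = n} (a-≡mod j) ⟩
    1 + j * (k * 2)    ≡⟨ cong (1 +_) (*-assoc j k 2) ⟨
    1 + j * k * 2      ≈⟨ x+k*m≡x-mod 1 (j * k) 2 ⟩
    1                  ∎
    where open ≈-Reasoning (≡mod-setoid 2)

  b-even : ∀ j → b j ≡ 0 mod 2
  b-even j = difference-≡mod-0 (a-odd j) (≡mod-trans (≡mod-*ʳ⇒≡mod {d = n} (a+b≡p₁ j)) p₁-odd)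

  a≢b : ∀ i j → a i ≢ b j
  a≢b i j = odd≢even (a-odd i) (b-even j)

  a≢a-mod : ∀ {i j} → i < j → j < n → ¬ a i ≡ a j mod N
  a≢a-mod {i} {j} i<j j<n ai≡aj =
    coprime⇒*≢0-mod k⊥n (m<n⇒0<n∸m i<j) (≤-<-trans (m∸n≤m j i) j<n) (≡mod-sym 0≡d*2k)
    where
    0≡d*2k : 0 ≡ (j ∸ i) * (k * 2) mod N
    0≡d*2k = +-cancelˡ-≡mod (1 + i * (k * 2)) (begin
      1 + i * (k * 2) + 0                      ≡⟨ +-identityʳ _ ⟩
      1 + i * (k * 2)                          ≈⟨ ≡mod-sym (a-≡mod i) ⟩
      a i                                      ≈⟨ ai≡aj ⟩
      a j                                      ≈⟨ a-≡mod j ⟩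
      1 + j * (k * 2)                          ≡⟨ cong (λ t → 1 + t * (k * 2)) (m+[n∸m]≡n (<⇒≤ i<j)) ⟨
      1 + (i + (j ∸ i)) * (k * 2)              ≡⟨ cong (1 +_) (*-distribʳ-+ (k * 2) i (j ∸ i)) ⟩
      1 + i * (k * 2) + (j ∸ i) * (k * 2)      ∎)
      where open ≈-Reasoning (≡mod-setoid N)

  a≢a : ∀ {i j} → i < j → j < n → a i ≢ a j
  a≢a i<j j<n = a≢a-mod i<j j<n ∘ ≡mod-reflexive

  b≢b : ∀ {i j} → i < j → j < n → b i ≢ b j
  b≢b {i} {j} i<j j<n bi≡bj = a≢a-mod i<j j<n (+-cancelˡ-≡mod (b j) (begin
    b j + a i        ≡⟨ +-comm (b j) (a i) ⟩
    a i + b j        ≡⟨ cong (a i +_) bi≡bj ⟨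
    a i + b i        ≈⟨ a+b≡p₁ i ⟩
    p₁               ≈⟨ ≡mod-sym (a+b≡p₁ j) ⟩
    a j + b j        ≡⟨ +-comm (a j) (b j) ⟩
    b j + a j        ∎))
    where open ≈-Reasoning (≡mod-setoid N)

  a-closes : a n ≡ 1
  a-closes = ≡mod-<⇒≡ (≤∧≢⇒< (proj₂ (a-range n)) an≢N) (*-monoʳ-≤ 2 (>-nonZero⁻¹ n)) (begin
    a n                  ≈⟨ a-≡mod n ⟩
    1 + n * (k * 2)      ≡⟨ cong (1 +_) (trans (*-comm n (k * 2)) (*-assoc k 2 n)) ⟩
    1 + k * N            ≈⟨ x+k*m≡x-mod 1 k N ⟩
    1                    ∎)
    where
    open ≈-Reasoning (≡mod-setoid N)
    an≢N : a n ≢ N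
    an≢N = odd≢even (a-odd n) (0 , n , trans (+-identityʳ N) (*-comm 2 n))

  walk : ℕ → ℕ → List ℕ
  walk j zero    = []
  walk j (suc r) = a j ∷ b j ∷ walk (suc j) r

  ∈-walk : ∀ {z} j r → z ∈ walk j r → ∃ λ i → j ≤ i × i < r + j × (z ≡ a i ⊎ z ≡ b i)
  ∈-walk j (suc r) (here refl)         = j , ≤-refl , s≤s (m≤n+m j r) , inj₁ refl
  ∈-walk j (suc r) (there (here refl)) = j , ≤-refl , s≤s (m≤n+m j r) , inj₂ refl
  ∈-walk j (suc r) (there (there z∈))  with ∈-walk (suc j) r z∈
  ... | i , j<i , i<r+1+j , z≡ = i , <⇒≤ j<i , subst (i <_) (+-suc r j) i<r+1+j , z≡

  walk-unique : ∀ j r → r + j ≤ n → Unique (walk j r)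
  walk-unique j zero    _     = []
  walk-unique j (suc r) r+j<n = All.tabulate a-fresh ∷ All.tabulate b-fresh ∷ walk-unique (suc j) r r+1+j≤n
    where
    r+1+j≤n : r + suc j ≤ n
    r+1+j≤n = subst (_≤ n) (sym (+-suc r j)) r+j<n
    a-fresh : ∀ {z} → z ∈ b j ∷ walk (suc j) r → a j ≢ z
    a-fresh (here refl) = a≢b j j
    a-fresh (there z∈) with ∈-walk (suc j) r z∈
    ... | i , j<i , i< , inj₁ refl = a≢a j<i (<-≤-trans i< r+1+j≤n)
    ... | i , _   , _  , inj₂ refl = a≢b j i
    b-fresh : ∀ {z} → z ∈ walk (suc j) r → b j ≢ z
    b-fresh z∈ with ∈-walk (suc j) r z∈
    ... | i , _   , _  , inj₁ refl = a≢b i j ∘ sym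
    ... | i , j<i , i< , inj₂ refl = b≢b j<i (<-≤-trans i< r+1+j≤n)

  walk-⊆ : walk 0 n ⊆ vertices N
  walk-⊆ z∈ with ∈-walk 0 n z∈
  ... | i , _ , _ , inj₁ refl = ∈-vertices (proj₁ (a-range i)) (proj₂ (a-range i))
  ... | i , _ , _ , inj₂ refl = ∈-vertices (proj₁ (b-range i)) (proj₂ (b-range i))

  length-walk : ∀ j r → length (walk j r) ≡ 2 * r
  length-walk j zero    = refl
  length-walk j (suc r) = trans (cong (suc ∘ suc) (length-walk (suc j) r)) (sym (*-suc 2 r))

  walk-↭ : walk 0 n ↭ vertices N
  walk-↭ = unique-⊆-↭ (walk-unique 0 n (≤-reflexive (+-identityʳ n))) walk-⊆
                       (trans (length-walk 0 n) (sym (length-vertices N)))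

  module _ (p₁-prime : Prime p₁ ⊎ p₁ ≡ 1) (p₂-prime : Prime p₂)
           (N+p₁-prime : Prime (N + p₁)) (N+p₂-prime : Prime (N + p₂)) where

    a~b : ∀ j → Adj (a j) (b j)
    a~b j = adj-of-sum p₁-prime N+p₁-prime (proj₁ (a-range j)) (proj₁ (b-range j))
                       (reflect-sum p₁ (proj₂ (a-range j)))

    b~a : ∀ j → Adj (b j) (a (suc j))
    b~a j = adj-of-sum (inj₁ p₂-prime) N+p₂-prime (proj₁ (b-range j)) (proj₁ (a-range (suc j)))
                       (reflect-sum p₂ (proj₂ (b-range j)))

    walk-chain : ∀ j r → AdjChain (a j) (b j ∷ walk (suc j) r) (a (suc r + j))
    walk-chain j zero    = a~b j , b~a j
    walk-chain j (suc r) = a~b j , b~a j , subst (AdjChain (a (suc j)) (b (suc j) ∷ walk (suc (suc j)) r) ∘ a ∘ suc)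
                                               (+-suc r j) (walk-chain (suc j) r)

    walk-cycleEdges : CycleEdges (walk 0 n)
    walk-cycleEdges = subst (CycleEdges ∘ walk 0) (suc-pred n)
      (chain⇒cycleEdges 1 _ (subst (AdjChain 1 _) closes (walk-chain 0 (pred n))))
      where
      closes : a (suc (pred n) + 0) ≡ 1
      closes = trans (cong a (trans (+-identityʳ (suc (pred n))) (suc-pred n))) a-closes

theorem3 : (n : ℕ) → 2 ≤ n →
    (p₁ p₂ : ℕ) → 1 ≤ p₁ → p₁ < p₂ → p₂ ≤ 2 * n →
    Prime p₂ → (Prime p₁ ⊎ p₁ ≡ 1) →
    Prime (2 * n + p₁) → Prime (2 * n + p₂) →
    gcd ((p₂ ∸ p₁) / 2) n ≡ 1 →
    HasHamiltonCycle (2 * n)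
theorem3 n 2≤n p₁ p₂ 1≤p₁ p₁<p₂ p₂≤2n p₂-prime p₁-prime 2n+p₁-prime 2n+p₂-prime gcd≡1 =
  walk 0 n , walk-↭ , walk-cycleEdges p₁-prime p₂-prime 2n+p₁-prime 2n+p₂-prime
  where
  instance
    n-nonZero : NonZero n
    n-nonZero = >-nonZero (<-≤-trans (s≤s z≤n) 2≤n)
  p₁-odd : p₁ ≡ 1 mod 2
  p₁-odd = odd-summand n p₁-prime 2n+p₁-prime
  p₂-odd : p₂ ≡ 1 mod 2
  p₂-odd = odd-summand n (inj₁ p₂-prime) 2n+p₂-prime
  open AlternatingWalk n ((p₂ ∸ p₁) / 2) p₁ p₂ 1≤p₁ (≤-trans (<⇒≤ p₁<p₂) p₂≤2n)
    (≤-trans 1≤p₁ (<⇒≤ p₁<p₂)) p₂≤2n p₁-odd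
    (≡mod-reflexive (odd-difference p₁-odd p₂-odd (<⇒≤ p₁<p₂))) (gcd≡1⇒coprime gcd≡1)
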